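{- Let $p\ge1$ be an integer. Let $U_p$ be the $(p+1)\times(p+1)$ matrix with rows and columns indexed by $0,\ldots,p$, whose $(i,j)$ entry for $0\le j\le p-1$ is $\frac{1}{(2(i-j)+1)!}$ if $i\ge j$ and $0$ if $i<j$, and whose last column is $(1,0,\ldots,0)^T$. Let $V_p$ be the analogous matrix with $(i,j)$ entry $\frac{1}{(2(i-j))!}$ if $i\ge j$ and $0$ if $i<j$ for $0\le j\le p-1$, and last column $(1,0,\ldots,0)^T$. Then $$B_{2p}=-\frac{(2p)!}{2^{2p}-2}\det U_p,\qquad E_{2p}=(2p)!\,\det V_p.$$
   Context: Bernoulli numbers: $\frac{z}{e^z-1}=\sum_q\frac{B_q}{q!}z^q$. Euler numbers: $\frac{1}{\cosh z}=\sum_q\frac{E_{q}}{q!}z^{q}$. -}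

module Defs where

open import Data.Nat as ℕ using (ℕ; zero; suc; _≤_; _<_; _∸_; _^_; _!; NonZero; z≤n; s≤s)
open import Data.Nat.Properties using (_!≢0; ^-monoʳ-<; m<n⇒0<n∸m; *-monoʳ-≤)
open import Data.Nat.Combinatorics using (_C_)
open import Data.Integer using (ℤ; +_)
open import Data.Rational using (ℚ; 0ℚ; 1ℚ; _+_; _*_; -_; _/_; _÷_)
open import Data.Fin using (Fin; zero; suc; toℕ; fromℕ; punchIn)
open import Data.Vec using (Vec; []; _∷_; _∷ʳ_; lookup)
open import Data.Bool using (Bool; true; false; if_then_else_)
open import Relation.Nullary.Decidable using (does)

Σ : (n : ℕ) → (Fin n → ℚ) → ℚ
Σ zero    f = 0ℚ
Σ (suc n) f = f zero + Σ n (λ i → f (suc i))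

invFact : ℕ → ℚ
invFact m = (+ 1) / (m !)
  where instance _ = m !≢0

fromℕ' : ℕ → ℚ
fromℕ' n = (+ n) / 1

-- Bernoulli numbers, z/(e^z-1) = Σ B_q z^q/q!.
-- Comparing coefficients of z^{n+1}/(n+1)! in  z = (e^z - 1) · Σ B_q z^q/q!
-- gives B_0 = 1 and  Σ_{k=0}^{n} C(n+1,k) B_k = 0 for n ≥ 1, i.e.
--   B_n = -(1/(n+1)) Σ_{k<n} C(n+1,k) B_k.
-- bernTable n = (B_0, …, B_n).

bernTable : (n : ℕ) → Vec ℚ (suc n)
bernTable zero    = 1ℚ ∷ []
bernTable (suc n) = T ∷ʳ new
  where
  T = bernTable n
  new : ℚ
  new = - ((Σ (suc n) (λ k → fromℕ' ((2 ℕ.+ n) C toℕ k) * lookup T k)) * ((+ 1) / (2 ℕ.+ n)))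

bernoulli : ℕ → ℚ
bernoulli n = lookup (bernTable n) (fromℕ n)

-- Euler numbers, 1/cosh z = Σ E_q z^q/q!.
-- Comparing coefficients in 1 = cosh z · Σ E_q z^q/q! gives E_0 = 1 and
-- Σ_{k ≤ n, n-k even} C(n,k) E_k = 0 for n ≥ 1, i.e.
--   E_n = - Σ_{k<n, n-k even} C(n,k) E_k.

even? : ℕ → Bool
even? zero = true
even? (suc zero) = false
even? (suc (suc n)) = even? n

eulerTable : (n : ℕ) → Vec ℚ (suc n)
eulerTable zero    = 1ℚ ∷ []
eulerTable (suc n) = T ∷ʳ new
  where
  T = eulerTable n
  new : ℚ
  new = - Σ (suc n) (λ k → if even? (suc n ∸ toℕ k)
                              then fromℕ' (suc n C toℕ k) * lookup T k
                              else 0ℚ)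

euler : ℕ → ℚ
euler n = lookup (eulerTable n) (fromℕ n)

sign : ℕ → ℚ
sign zero          = 1ℚ
sign (suc zero)    = - 1ℚ
sign (suc (suc n)) = sign n

det : (n : ℕ) → (Fin n → Fin n → ℚ) → ℚ
det zero    M = 1ℚ
det (suc n) M =
  Σ (suc n) (λ j → sign (toℕ j) * M zero j * det n (λ r c → M (suc r) (punchIn j c)))

shapeMatrix : (p : ℕ) → (ℕ → ℚ) → Fin (suc p) → Fin (suc p) → ℚ
shapeMatrix p f i j =
  if does (toℕ j ℕ.≟ p)
    then (if does (toℕ i ℕ.≟ 0) then 1ℚ else 0ℚ)
    else (if does (toℕ j ℕ.≤? toℕ i) then f (toℕ i ∸ toℕ j) else 0ℚ)

U : (p : ℕ) → Fin (suc p) → Fin (suc p) → ℚ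
U p = shapeMatrix p (λ d → invFact (2 ℕ.* d ℕ.+ 1))

V : (p : ℕ) → Fin (suc p) → Fin (suc p) → ℚ
V p = shapeMatrix p (λ d → invFact (2 ℕ.* d))

denomNZ : (p : ℕ) → 1 ≤ p → NonZero (2 ^ (2 ℕ.* p) ∸ 2)
denomNZ p 1≤p = ℕ.>-nonZero (m<n⇒0<n∸m lt)
  where
  lt : 2 < 2 ^ (2 ℕ.* p)
  lt = ^-monoʳ-< 2 (s≤s (s≤s z≤n)) {1} {2 ℕ.* p} (*-monoʳ-≤ 2 1≤p)

coeffB : (p : ℕ) → 1 ≤ p → ℚ
coeffB p 1≤p = (+ ((2 ℕ.* p) !)) / (2 ^ (2 ℕ.* p) ∸ 2)
  where instance _ = denomNZ p 1≤p

{-# OPTIONS --safe #-}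
-- Read as exponential generating functions, the recurrences defining the
-- Bernoulli and Euler numbers say that β(z) = Σ B_k z^k/k! and Σ E_k z^k/k! are
-- the reciprocals of (eᶻ - 1)/z and cosh z in the ring of formal power series
-- over ℚ. The identity 2z/(eᶻ - 1) - 2z/(e²ᶻ - 1) = z/sinh z shows that
-- 2β(z) - β(2z) is the reciprocal of sinh z / z; its coefficient of z^2p is
-- (2 - 2^2p) B_2p/(2p)!. Both sinh z / z and cosh z have the form f(z²) with
-- f(0) = 1, and expanding along the first row shows that the coefficient of w^p
-- in 1/f(w) is det (shapeMatrix p f), which is det U_p, resp. det V_p.
module Submission where

open import Defs
open import Data.Nat using (ℕ; suc; _≤_; _!) renaming (_*_ to _*ℕ_)
open import Data.Product using (_×_; _,_)
open import Data.Rational using (_*_; -_)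
open import Relation.Binary.PropositionalEquality using (_≡_)

open import Algebra.Bundles using (Ring; CommutativeRing)
open import Data.Bool using (true; false; if_then_else_)
open import Data.Fin using (Fin; zero; suc; toℕ; fromℕ; punchIn; punchOut; inject₁)
import Data.Fin.Properties as Fin
open import Data.Fin.Relation.Unary.Top using (view; ‵fromℕ; ‵inject₁)
import Data.Integer as ℤ
import Data.Integer.Tactic.RingSolver as ℤ-Solver
open import Data.Nat as ℕ using (zero; _<_; _∸_; NonZero; z≤n; s≤s)
import Data.Nat.Properties as ℕ
open import Data.Nat.Combinatorics using (_C_; nCk≡nC[n∸k]; nC1≡n; nCn≡1; k![n∸k]!∣n!)
open import Data.Nat.Combinatorics.Specification using (nCk≡n!/k![n-k]!)
open import Data.Nat.Coprimality as Coprime using (1-coprimeTo)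
open import Data.Nat.DivMod using (m/n*n≡m)
open import Data.Rational as ℚ using (ℚ; mkℚ; toℚᵘ; 0ℚ; 1ℚ; _+_; _/_)
open import Data.Rational.Properties
import Data.Rational.Unnormalised as ℚᵘ
import Data.Rational.Unnormalised.Properties as ℚᵘ
open import Data.Sum using (_⊎_; inj₁; inj₂)
open import Data.Vec using (Vec; []; _∷_; _∷ʳ_; lookup)
open import Function using (_∘_)
open import Level using (0ℓ)
open import Relation.Binary.PropositionalEquality
  using (refl; sym; trans; cong; cong₂; _≗_; _≢_; module ≡-Reasoning)
open import Relation.Nullary using (Dec; yes; no; does; ¬_)
open import Relation.Nullary.Decidable using (dec⇒maybe; dec-true; dec-false)
open import Tactic.RingSolver using (solve-∀)
open import Tactic.RingSolver.Core.AlmostCommutativeRing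
  using (AlmostCommutativeRing; fromCommutativeRing)

open import Algebra.Definitions.RawMonoid ℚ.+-0-rawMonoid using () renaming (sum to ∑)
open import Algebra.Definitions.RawSemiring +-*-rawSemiring using (_^_) renaming (_×_ to _×ₙ_)
open import Algebra.Properties.Group +-0-group using () renaming (⁻¹-involutive to neg-involutive)
open import Algebra.Properties.Monoid.Mult +-0-monoid using (×-homo-+)
open import Algebra.Properties.Semiring.Exp (Ring.semiring +-*-ring) using (^-homo-*)
open import Algebra.Properties.Semiring.Mult (Ring.semiring +-*-ring) using (×1-homo-*; ×-assoc-*)
import Algebra.Properties.CommutativeSemiring.Binomial
  (CommutativeRing.commutativeSemiring +-*-commutativeRing) as Binomial

open ≡-Reasoning

ℚ-ring : AlmostCommutativeRing 0ℓ 0ℓ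
ℚ-ring = fromCommutativeRing +-*-commutativeRing (λ x → dec⇒maybe (0ℚ ≟ x))

fromℕ'≡mkℚ : ∀ n → fromℕ' n ≡ mkℚ (ℤ.+ n) 0 (Coprime.sym (1-coprimeTo n))
fromℕ'≡mkℚ n = normalize-coprime (Coprime.sym (1-coprimeTo n))

fromℕ'-suc : ∀ n → fromℕ' (suc n) ≡ 1ℚ + fromℕ' n
fromℕ'-suc n = begin
  ℤ.+ suc n / 1                                      ≡⟨ cong (_/ 1) (solve (ℤ.+ n)) ⟩
  (ℤ.+ 1 ℤ.* ℤ.+ 1 ℤ.+ ℤ.+ n ℤ.* ℤ.+ 1) / 1          ≡⟨⟩
  1ℚ + mkℚ (ℤ.+ n) 0 (Coprime.sym (1-coprimeTo n))   ≡⟨ cong (1ℚ +_) (fromℕ'≡mkℚ n) ⟨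
  1ℚ + fromℕ' n                                      ∎
  where
  solve : ∀ m → ℤ.+ 1 ℤ.+ m ≡ ℤ.+ 1 ℤ.* ℤ.+ 1 ℤ.+ m ℤ.* ℤ.+ 1
  solve = ℤ-Solver.solve-∀

fromℕ'≡×1 : ∀ n → fromℕ' n ≡ n ×ₙ 1ℚ
fromℕ'≡×1 zero    = refl
fromℕ'≡×1 (suc n) = trans (fromℕ'-suc n) (cong (1ℚ +_) (fromℕ'≡×1 n))

fromℕ'-+ : ∀ m n → fromℕ' (m ℕ.+ n) ≡ fromℕ' m + fromℕ' n
fromℕ'-+ m n = begin
  fromℕ' (m ℕ.+ n)      ≡⟨ fromℕ'≡×1 (m ℕ.+ n) ⟩
  (m ℕ.+ n) ×ₙ 1ℚ       ≡⟨ ×-homo-+ 1ℚ m n ⟩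
  m ×ₙ 1ℚ + n ×ₙ 1ℚ     ≡⟨ cong₂ _+_ (fromℕ'≡×1 m) (fromℕ'≡×1 n) ⟨
  fromℕ' m + fromℕ' n   ∎

fromℕ'-* : ∀ m n → fromℕ' (m ℕ.* n) ≡ fromℕ' m * fromℕ' n
fromℕ'-* m n = begin
  fromℕ' (m ℕ.* n)      ≡⟨ fromℕ'≡×1 (m ℕ.* n) ⟩
  (m ℕ.* n) ×ₙ 1ℚ       ≡⟨ ×1-homo-* m n ⟩
  m ×ₙ 1ℚ * n ×ₙ 1ℚ     ≡⟨ cong₂ _*_ (fromℕ'≡×1 m) (fromℕ'≡×1 n) ⟨
  fromℕ' m * fromℕ' n   ∎

fromℕ'-^ : ∀ m n → fromℕ' (m ℕ.^ n) ≡ fromℕ' m ^ n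
fromℕ'-^ m zero    = refl
fromℕ'-^ m (suc n) = trans (fromℕ'-* m (m ℕ.^ n)) (cong (fromℕ' m *_) (fromℕ'-^ m n))

/-*-fromℕ' : ∀ i n .{{_ : NonZero n}} → (i / n) * fromℕ' n ≡ i / 1
/-*-fromℕ' i (suc d) = toℚᵘ-injective (ℚᵘ.≃-trans product-of-unnormalised
  (ℚᵘ.≃-trans (ℚᵘ.*≡* (solve i (ℤ.+ suc d))) (ℚᵘ.≃-sym (toℚᵘ-fromℚᵘ (ℚᵘ.mkℚᵘ i 0)))))
  where
  product-of-unnormalised :
    toℚᵘ (i / suc d * fromℕ' (suc d)) ℚᵘ.≃ ℚᵘ.mkℚᵘ i d ℚᵘ.* ℚᵘ.mkℚᵘ (ℤ.+ suc d) 0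
  product-of-unnormalised = ℚᵘ.≃-trans (toℚᵘ-homo-* (i / suc d) (fromℕ' (suc d)))
    (ℚᵘ.*-cong (toℚᵘ-fromℚᵘ (ℚᵘ.mkℚᵘ i d)) (ℚᵘ.≃-reflexive (cong toℚᵘ (fromℕ'≡mkℚ (suc d)))))
  solve : ∀ a b → (a ℤ.* b) ℤ.* ℤ.+ 1 ≡ a ℤ.* (b ℤ.* ℤ.+ 1)
  solve = ℤ-Solver.solve-∀

invFact-inverse : ∀ m → invFact m * fromℕ' (m !) ≡ 1ℚ
invFact-inverse m = /-*-fromℕ' (ℤ.+ 1) (m !) {{m ℕ.!≢0}}

nCk*[k!*[n∸k]!]≡n! : ∀ {n k} → k ≤ n → (n C k) ℕ.* (k ! ℕ.* (n ∸ k) !) ≡ n !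
nCk*[k!*[n∸k]!]≡n! {n} {k} k≤n = begin
  (n C k) ℕ.* (k ! ℕ.* (n ∸ k) !)                       ≡⟨ cong (ℕ._* (k ! ℕ.* (n ∸ k) !)) (nCk≡n!/k![n-k]! k≤n) ⟩
  n ! ℕ./ (k ! ℕ.* (n ∸ k) !) ℕ.* (k ! ℕ.* (n ∸ k) !)   ≡⟨ m/n*n≡m (k![n∸k]!∣n! k≤n) ⟩
  n !                                                   ∎
  where instance _ = ℕ._!*_!≢0 k (n ∸ k)

invFact-binomial : ∀ {n k} → k ≤ n → invFact k * invFact (n ∸ k) ≡ fromℕ' (n C k) * invFact n
invFact-binomial {n} {k} k≤n = begin
  a * b                                ≡⟨ *-identityʳ (a * b) ⟨
  a * b * 1ℚ                           ≡⟨ cong (a * b *_) (invFact-inverse n) ⟨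
  a * b * (c * fromℕ' (n !))           ≡⟨ cong (λ x → a * b * (c * x)) factorials ⟨
  a * b * (c * (binom * (x * y)))      ≡⟨ regroup a b c binom x y ⟩
  binom * c * (a * x) * (b * y)        ≡⟨ cong₂ (λ u v → binom * c * u * v) (invFact-inverse k) (invFact-inverse (n ∸ k)) ⟩
  binom * c * 1ℚ * 1ℚ                  ≡⟨ trans (*-identityʳ _) (*-identityʳ _) ⟩
  binom * c                            ∎
  where
  a = invFact k
  b = invFact (n ∸ k)
  c = invFact n
  binom = fromℕ' (n C k)
  x = fromℕ' (k !)
  y = fromℕ' ((n ∸ k) !)
  factorials : binom * (x * y) ≡ fromℕ' (n !)
  factorials = begin
    binom * (x * y)                              ≡⟨ cong (binom *_) (fromℕ'-* (k !) ((n ∸ k) !)) ⟨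
    binom * fromℕ' (k ! ℕ.* (n ∸ k) !)           ≡⟨ fromℕ'-* (n C k) _ ⟨
    fromℕ' ((n C k) ℕ.* (k ! ℕ.* (n ∸ k) !))     ≡⟨ cong fromℕ' (nCk*[k!*[n∸k]!]≡n! k≤n) ⟩
    fromℕ' (n !)                                 ∎
  regroup : ∀ a b c C x y → a * b * (c * (C * (x * y))) ≡ C * c * (a * x) * (b * y)
  regroup = solve-∀ ℚ-ring

*-cancelˡ-≡ : ∀ c .{{_ : ℚ.NonZero c}} {a b} → c * a ≡ c * b → a ≡ b
*-cancelˡ-≡ c {a} {b} ca≡cb = begin
  a                 ≡⟨ *-identityˡ a ⟨
  1ℚ * a            ≡⟨ cong (_* a) (*-inverseˡ c) ⟨
  ℚ.1/ c * c * a    ≡⟨ *-assoc (ℚ.1/ c) c a ⟩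
  ℚ.1/ c * (c * a)  ≡⟨ cong (ℚ.1/ c *_) ca≡cb ⟩
  ℚ.1/ c * (c * b)  ≡⟨ *-assoc (ℚ.1/ c) c b ⟨
  ℚ.1/ c * c * b    ≡⟨ cong (_* b) (*-inverseˡ c) ⟩
  1ℚ * b            ≡⟨ *-identityˡ b ⟩
  b                 ∎

-- Formal power series

sum : ℕ → (ℕ → ℚ) → ℚ
sum zero    f = 0ℚ
sum (suc n) f = f 0 + sum n (λ k → f (suc k))

sum-cong : ∀ n {f g : ℕ → ℚ} → (∀ k → k < n → f k ≡ g k) → sum n f ≡ sum n g
sum-cong zero    f≡g = refl
sum-cong (suc n) f≡g = cong₂ _+_ (f≡g 0 (s≤s z≤n)) (sum-cong n (λ k k<n → f≡g (suc k) (s≤s k<n)))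

sum-+ : ∀ n (f g : ℕ → ℚ) → sum n (λ k → f k + g k) ≡ sum n f + sum n g
sum-+ zero    f g = refl
sum-+ (suc n) f g = begin
  (f 0 + g 0) + sum n (λ k → f (suc k) + g (suc k))   ≡⟨ cong ((f 0 + g 0) +_) (sum-+ n _ _) ⟩
  (f 0 + g 0) + (sum n _ + sum n _)                   ≡⟨ interchange (f 0) (g 0) _ _ ⟩
  (f 0 + sum n _) + (g 0 + sum n _)                   ∎
  where
  interchange : ∀ a b c d → (a + b) + (c + d) ≡ (a + c) + (b + d)
  interchange = solve-∀ ℚ-ring

*-distribˡ-sum : ∀ n c (f : ℕ → ℚ) → c * sum n f ≡ sum n (λ k → c * f k)
*-distribˡ-sum zero    c f = *-zeroʳ c
*-distribˡ-sum (suc n) c f = trans (*-distribˡ-+ c (f 0) _) (cong (c * f 0 +_) (*-distribˡ-sum n c _))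

sum-snoc : ∀ n (f : ℕ → ℚ) → sum (suc n) f ≡ sum n f + f n
sum-snoc zero    f = trans (+-identityʳ (f 0)) (sym (+-identityˡ (f 0)))
sum-snoc (suc n) f = trans (cong (f 0 +_) (sum-snoc n _)) (sym (+-assoc (f 0) _ _))

sum-reverse : ∀ n (f : ℕ → ℚ) → sum n f ≡ sum n (λ k → f (n ∸ suc k))
sum-reverse zero    f = refl
sum-reverse (suc n) f = begin
  f 0 + sum n (λ k → f (suc k))                  ≡⟨ cong (f 0 +_) (sum-reverse n _) ⟩
  f 0 + sum n (λ k → f (suc (n ∸ suc k)))        ≡⟨ +-comm (f 0) _ ⟩
  sum n (λ k → f (suc (n ∸ suc k))) + f 0        ≡⟨ cong₂ _+_ (sum-cong n λ k k<n → cong f (ℕ.+-∸-assoc 1 k<n))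
                                                              (cong f (ℕ.n∸n≡0 n)) ⟨
  sum n (λ k → f (n ∸ k)) + f (n ∸ n)            ≡⟨ sum-snoc n (λ k → f (n ∸ k)) ⟨
  sum (suc n) (λ k → f (n ∸ k))                  ∎

∑≡sum : ∀ n (f : ℕ → ℚ) → ∑ (λ (i : Fin n) → f (toℕ i)) ≡ sum n f
∑≡sum zero    f = refl
∑≡sum (suc n) f = cong (f 0 +_) (∑≡sum n (λ k → f (suc k)))

Σ≡sum : ∀ n (f : ℕ → ℚ) → Σ n (λ i → f (toℕ i)) ≡ sum n f
Σ≡sum zero    f = refl
Σ≡sum (suc n) f = cong (f 0 +_) (Σ≡sum n (λ k → f (suc k)))

Series : Set
Series = ℕ → ℚ

infixl 7 _⋆_ _·_
infixl 6 _⊕_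

_⋆_ : Series → Series → Series
(a ⋆ b) n = sum (suc n) (λ k → a k * b (n ∸ k))

_⊕_ : Series → Series → Series
(a ⊕ b) n = a n + b n

_·_ : ℚ → Series → Series
(c · a) n = c * a n

𝟙 : Series
𝟙 zero    = 1ℚ
𝟙 (suc _) = 0ℚ

⋆-congˡ : ∀ {a a'} b → a ≗ a' → a ⋆ b ≗ a' ⋆ b
⋆-congˡ b a≗a' n = sum-cong (suc n) λ k _ → cong (_* b (n ∸ k)) (a≗a' k)

⋆-congʳ : ∀ a {b b'} → b ≗ b' → a ⋆ b ≗ a ⋆ b'
⋆-congʳ a b≗b' n = sum-cong (suc n) λ k _ → cong (a k *_) (b≗b' (n ∸ k))

⋆-comm : ∀ a b → a ⋆ b ≗ b ⋆ a
⋆-comm a b n = begin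
  sum (suc n) (λ k → a k * b (n ∸ k))                 ≡⟨ sum-reverse (suc n) (λ k → a k * b (n ∸ k)) ⟩
  sum (suc n) (λ k → a (n ∸ k) * b (n ∸ (n ∸ k)))     ≡⟨ sum-cong (suc n) swap ⟩
  sum (suc n) (λ k → b k * a (n ∸ k))                 ∎
  where
  swap : ∀ k → k < suc n → a (n ∸ k) * b (n ∸ (n ∸ k)) ≡ b k * a (n ∸ k)
  swap k k≤n = trans (*-comm (a (n ∸ k)) _) (cong (λ j → b j * a (n ∸ k)) (ℕ.m∸[m∸n]≡n (ℕ.≤-pred k≤n)))

⋆-distribʳ-⊕ : ∀ a a' b → (a ⊕ a') ⋆ b ≗ a ⋆ b ⊕ a' ⋆ b
⋆-distribʳ-⊕ a a' b n = trans (sum-cong (suc n) λ k _ → *-distribʳ-+ (b (n ∸ k)) (a k) (a' k))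
                               (sum-+ (suc n) (λ k → a k * b (n ∸ k)) (λ k → a' k * b (n ∸ k)))

⋆-distribˡ-⊕ : ∀ a b b' → a ⋆ (b ⊕ b') ≗ a ⋆ b ⊕ a ⋆ b'
⋆-distribˡ-⊕ a b b' n = begin
  (a ⋆ (b ⊕ b')) n          ≡⟨ ⋆-comm a (b ⊕ b') n ⟩
  ((b ⊕ b') ⋆ a) n          ≡⟨ ⋆-distribʳ-⊕ b b' a n ⟩
  (b ⋆ a) n + (b' ⋆ a) n    ≡⟨ cong₂ _+_ (⋆-comm b a n) (⋆-comm b' a n) ⟩
  (a ⋆ b) n + (a ⋆ b') n    ∎

·-⋆ : ∀ c a b → (c · a) ⋆ b ≗ c · (a ⋆ b)
·-⋆ c a b n = trans (sum-cong (suc n) λ k _ → *-assoc c (a k) (b (n ∸ k)))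
                    (sym (*-distribˡ-sum (suc n) c (λ k → a k * b (n ∸ k))))

⋆-· : ∀ c a b → a ⋆ (c · b) ≗ c · (a ⋆ b)
⋆-· c a b n = trans (⋆-comm a (c · b) n) (trans (·-⋆ c b a n) (cong (c *_) (⋆-comm b a n)))

⋆-assoc : ∀ a b c → (a ⋆ b) ⋆ c ≗ a ⋆ (b ⋆ c)
⋆-assoc a b c zero    = solve (a 0) (b 0) (c 0)
  where
  solve : ∀ x y z → (x * y + 0ℚ) * z + 0ℚ ≡ x * (y * z + 0ℚ) + 0ℚ
  solve = solve-∀ ℚ-ring
⋆-assoc a b c (suc m) = begin
  (a ⋆ b) 0 * c (suc m) + ((a 0 · b⁺ ⊕ a⁺ ⋆ b) ⋆ c) m
    ≡⟨ cong ((a ⋆ b) 0 * c (suc m) +_) (⋆-distribʳ-⊕ (a 0 · b⁺) (a⁺ ⋆ b) c m) ⟩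
  (a ⋆ b) 0 * c (suc m) + (((a 0 · b⁺) ⋆ c) m + ((a⁺ ⋆ b) ⋆ c) m)
    ≡⟨ cong₂ (λ u v → (a ⋆ b) 0 * c (suc m) + (u + v)) (·-⋆ (a 0) b⁺ c m) (⋆-assoc a⁺ b c m) ⟩
  (a 0 * b 0 + 0ℚ) * c (suc m) + (a 0 * (b⁺ ⋆ c) m + (a⁺ ⋆ (b ⋆ c)) m)
    ≡⟨ solve (a 0) (b 0) (c (suc m)) _ _ ⟩
  a 0 * (b 0 * c (suc m) + (b⁺ ⋆ c) m) + (a⁺ ⋆ (b ⋆ c)) m
    ∎
  where
  a⁺ b⁺ : Series
  a⁺ k = a (suc k)
  b⁺ k = b (suc k)
  solve : ∀ x y z u v → (x * y + 0ℚ) * z + (x * u + v) ≡ x * (y * z + u) + v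
  solve = solve-∀ ℚ-ring

𝟙-⋆ : ∀ b → 𝟙 ⋆ b ≗ b
𝟙-⋆ b n = begin
  1ℚ * b n + sum n (λ k → 0ℚ * b (n ∸ suc k))   ≡⟨ cong (1ℚ * b n +_) (*-distribˡ-sum n 0ℚ (λ k → b (n ∸ suc k))) ⟨
  1ℚ * b n + 0ℚ * sum n (λ k → b (n ∸ suc k))   ≡⟨ solve (b n) (sum n (λ k → b (n ∸ suc k))) ⟩
  b n                                           ∎
  where
  solve : ∀ x y → 1ℚ * x + 0ℚ * y ≡ x
  solve = solve-∀ ℚ-ring

⋆-𝟙 : ∀ a → a ⋆ 𝟙 ≗ a
⋆-𝟙 a n = trans (⋆-comm a 𝟙 n) (𝟙-⋆ a n)

inverse-⋆-cancel : ∀ a b c → a ⋆ b ≗ 𝟙 → a ⋆ (b ⋆ c) ≗ c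
inverse-⋆-cancel a b c a⋆b≗𝟙 n = begin
  (a ⋆ (b ⋆ c)) n   ≡⟨ ⋆-assoc a b c n ⟨
  ((a ⋆ b) ⋆ c) n   ≡⟨ ⋆-congˡ c a⋆b≗𝟙 n ⟩
  (𝟙 ⋆ c) n         ≡⟨ 𝟙-⋆ c n ⟩
  c n               ∎

inverse-unique : ∀ a b t → a ⋆ t ≗ 𝟙 → b ⋆ t ≗ 𝟙 → a ≗ b
inverse-unique a b t a⋆t≗𝟙 b⋆t≗𝟙 n = begin
  a n               ≡⟨ ⋆-𝟙 a n ⟨
  (a ⋆ 𝟙) n         ≡⟨ ⋆-congʳ a (λ k → trans (sym (b⋆t≗𝟙 k)) (⋆-comm b t k)) n ⟩
  (a ⋆ (t ⋆ b)) n   ≡⟨ inverse-⋆-cancel a t b a⋆t≗𝟙 n ⟩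
  b n               ∎

dilate : ℚ → Series → Series
dilate c a k = c ^ k * a k

dilate-⋆ : ∀ c a b → dilate c (a ⋆ b) ≗ dilate c a ⋆ dilate c b
dilate-⋆ c a b n = begin
  c ^ n * sum (suc n) (λ k → a k * b (n ∸ k))             ≡⟨ *-distribˡ-sum (suc n) (c ^ n) (λ k → a k * b (n ∸ k)) ⟩
  sum (suc n) (λ k → c ^ n * (a k * b (n ∸ k)))           ≡⟨ sum-cong (suc n) split-power ⟩
  sum (suc n) (λ k → dilate c a k * dilate c b (n ∸ k))   ∎
  where
  split-power : ∀ k → k < suc n → c ^ n * (a k * b (n ∸ k)) ≡ dilate c a k * dilate c b (n ∸ k)
  split-power k k≤n = begin
    c ^ n * (a k * b (n ∸ k))                    ≡⟨ cong (λ j → c ^ j * (a k * b (n ∸ k))) (ℕ.m+[n∸m]≡n (ℕ.≤-pred k≤n)) ⟨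
    c ^ (k ℕ.+ (n ∸ k)) * (a k * b (n ∸ k))      ≡⟨ cong (_* (a k * b (n ∸ k))) (^-homo-* c k (n ∸ k)) ⟩
    c ^ k * c ^ (n ∸ k) * (a k * b (n ∸ k))      ≡⟨ solve (c ^ k) (c ^ (n ∸ k)) (a k) (b (n ∸ k)) ⟩
    c ^ k * a k * (c ^ (n ∸ k) * b (n ∸ k))      ∎
    where
    solve : ∀ p q x y → p * q * (x * y) ≡ p * x * (q * y)
    solve = solve-∀ ℚ-ring

dilate-𝟙 : ∀ c → dilate c 𝟙 ≗ 𝟙
dilate-𝟙 c zero    = refl
dilate-𝟙 c (suc n) = *-zeroʳ (c ^ suc n)

dilate-inverse : ∀ c a b → a ⋆ b ≗ 𝟙 → dilate c a ⋆ dilate c b ≗ 𝟙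
dilate-inverse c a b a⋆b≗𝟙 n = begin
  (dilate c a ⋆ dilate c b) n   ≡⟨ dilate-⋆ c a b n ⟨
  c ^ n * (a ⋆ b) n             ≡⟨ cong (c ^ n *_) (a⋆b≗𝟙 n) ⟩
  dilate c 𝟙 n                  ≡⟨ dilate-𝟙 c n ⟩
  𝟙 n                           ∎

exp : ℚ → Series
exp x k = x ^ k * invFact k

×ₙ≡fromℕ'* : ∀ n x → n ×ₙ x ≡ fromℕ' n * x
×ₙ≡fromℕ'* n x = begin
  n ×ₙ x               ≡⟨ cong (n ×ₙ_) (*-identityˡ x) ⟨
  n ×ₙ (1ℚ * x)        ≡⟨ ×-assoc-* n 1ℚ x ⟨
  n ×ₙ 1ℚ * x          ≡⟨ cong (_* x) (fromℕ'≡×1 n) ⟨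
  fromℕ' n * x         ∎

exp-⋆ : ∀ x y → exp x ⋆ exp y ≗ exp (x + y)
exp-⋆ x y n = begin
  sum (suc n) (λ k → exp x k * exp y (n ∸ k))    ≡⟨ sum-cong (suc n) binomial-term ⟩
  sum (suc n) (λ k → invFact n * term k)         ≡⟨ *-distribˡ-sum (suc n) (invFact n) term ⟨
  invFact n * sum (suc n) term                   ≡⟨ cong (invFact n *_) (∑≡sum (suc n) term) ⟨
  invFact n * Binomial.binomialExpansion x y n   ≡⟨ cong (invFact n *_) (Binomial.theorem n x y) ⟨
  invFact n * (x + y) ^ n                        ≡⟨ *-comm (invFact n) _ ⟩
  exp (x + y) n                                  ∎
  where
  term : ℕ → ℚ
  term k = (n C k) ×ₙ (x ^ k * y ^ (n ∸ k))
  binomial-term : ∀ k → k < suc n → exp x k * exp y (n ∸ k) ≡ invFact n * term k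
  binomial-term k k≤n = begin
    x ^ k * invFact k * (y ^ (n ∸ k) * invFact (n ∸ k))       ≡⟨ solve (x ^ k) (y ^ (n ∸ k)) (invFact k) _ ⟩
    (invFact k * invFact (n ∸ k)) * (x ^ k * y ^ (n ∸ k))     ≡⟨ cong (_* (x ^ k * y ^ (n ∸ k))) (invFact-binomial (ℕ.≤-pred k≤n)) ⟩
    fromℕ' (n C k) * invFact n * (x ^ k * y ^ (n ∸ k))        ≡⟨ solve′ (fromℕ' (n C k)) (invFact n) (x ^ k * y ^ (n ∸ k)) ⟩
    invFact n * (fromℕ' (n C k) * (x ^ k * y ^ (n ∸ k)))      ≡⟨ cong (invFact n *_) (×ₙ≡fromℕ'* (n C k) _) ⟨
    invFact n * term k                                        ∎
    where
    solve : ∀ p q i j → p * i * (q * j) ≡ (i * j) * (p * q)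
    solve = solve-∀ ℚ-ring
    solve′ : ∀ c i p → c * i * p ≡ i * (c * p)
    solve′ = solve-∀ ℚ-ring

exp-0 : exp 0ℚ ≗ 𝟙
exp-0 zero    = refl
exp-0 (suc n) = trans (cong (_* invFact (suc n)) (*-zeroˡ (0ℚ ^ n))) (*-zeroˡ (invFact (suc n)))

-- spread b is the series b(z²)
spread : Series → Series
spread b zero          = b 0
spread b (suc zero)    = 0ℚ
spread b (suc (suc n)) = spread (λ k → b (suc k)) n

spread-2* : ∀ b p → spread b (2 ℕ.* p) ≡ b p
spread-2* b zero    = refl
spread-2* b (suc p) = trans (cong (spread b) (ℕ.*-suc 2 p)) (spread-2* (λ k → b (suc k)) p)

spread-cong : ∀ {b c} → b ≗ c → spread b ≗ spread c
spread-cong b≗c zero          = b≗c 0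
spread-cong b≗c (suc zero)    = refl
spread-cong b≗c (suc (suc n)) = spread-cong (λ k → b≗c (suc k)) n

spread-affine : ∀ x u v → spread (x · u ⊕ v) ≗ x · spread u ⊕ spread v
spread-affine x u v zero          = refl
spread-affine x u v (suc zero)    = sym (trans (+-identityʳ (x * 0ℚ)) (*-zeroʳ x))
spread-affine x u v (suc (suc n)) = spread-affine x (λ k → u (suc k)) (λ k → v (suc k)) n

spread-⋆ : ∀ b c → spread b ⋆ spread c ≗ spread (b ⋆ c)
spread-⋆ b c zero          = refl
spread-⋆ b c (suc zero)    = solve (b 0) (c 0)
  where
  solve : ∀ x y → x * 0ℚ + (0ℚ * y + 0ℚ) ≡ 0ℚ
  solve = solve-∀ ℚ-ring
spread-⋆ b c (suc (suc m)) = begin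
  b 0 * spread c⁺ m + (0ℚ * spread c (suc m) + (spread b⁺ ⋆ spread c) m)
    ≡⟨ cong (λ z → b 0 * spread c⁺ m + (0ℚ * spread c (suc m) + z)) (spread-⋆ b⁺ c m) ⟩
  b 0 * spread c⁺ m + (0ℚ * spread c (suc m) + spread (b⁺ ⋆ c) m)
    ≡⟨ solve (b 0) (spread c⁺ m) (spread c (suc m)) (spread (b⁺ ⋆ c) m) ⟩
  b 0 * spread c⁺ m + spread (b⁺ ⋆ c) m
    ≡⟨ spread-affine (b 0) c⁺ (b⁺ ⋆ c) m ⟨
  spread (b 0 · c⁺ ⊕ b⁺ ⋆ c) m
    ∎
  where
  b⁺ c⁺ : Series
  b⁺ k = b (suc k)
  c⁺ k = c (suc k)
  solve : ∀ x y z w → x * y + (0ℚ * z + w) ≡ x * y + w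
  solve = solve-∀ ℚ-ring

spread-𝟙 : spread 𝟙 ≗ 𝟙
spread-𝟙 zero          = refl
spread-𝟙 (suc zero)    = refl
spread-𝟙 (suc (suc n)) = spread-zero n
  where
  spread-zero : ∀ n → spread (λ _ → 0ℚ) n ≡ 0ℚ
  spread-zero zero          = refl
  spread-zero (suc zero)    = refl
  spread-zero (suc (suc n)) = spread-zero n

spread-inverse : ∀ b c → b ⋆ c ≗ 𝟙 → spread b ⋆ spread c ≗ 𝟙
spread-inverse b c b⋆c≗𝟙 n =
  trans (spread-⋆ b c n) (trans (spread-cong b⋆c≗𝟙 n) (spread-𝟙 n))

spread-even? : ∀ (b f : Series) → (∀ d → b d ≡ f (2 ℕ.* d)) →
               ∀ j → spread b j ≡ (if even? j then f j else 0ℚ)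
spread-even? b f b≡f zero          = b≡f 0
spread-even? b f b≡f (suc zero)    = refl
spread-even? b f b≡f (suc (suc j)) =
  spread-even? (λ k → b (suc k)) (λ k → f (suc (suc k))) (λ d → trans (b≡f (suc d)) (cong f (ℕ.*-suc 2 d))) j

-- Determinants and reciprocals

Σ-cong : ∀ n {h h' : Fin n → ℚ} → (∀ i → h i ≡ h' i) → Σ n h ≡ Σ n h'
Σ-cong zero    h≡h' = refl
Σ-cong (suc n) h≡h' = cong₂ _+_ (h≡h' zero) (Σ-cong n (λ i → h≡h' (suc i)))

Σ-zero : ∀ n (h : Fin n → ℚ) → (∀ i → h i ≡ 0ℚ) → Σ n h ≡ 0ℚ
Σ-zero zero    h h≡0 = refl
Σ-zero (suc n) h h≡0 = cong₂ _+_ (h≡0 zero) (Σ-zero n (λ i → h (suc i)) (λ i → h≡0 (suc i)))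

Σ-single : ∀ n (h : Fin n → ℚ) k → (∀ j → j ≢ k → h j ≡ 0ℚ) → Σ n h ≡ h k
Σ-single (suc n) h zero    h≡0 =
  trans (cong (h zero +_) (Σ-zero n (λ i → h (suc i)) (λ i → h≡0 (suc i) λ ())))
        (+-identityʳ (h zero))
Σ-single (suc n) h (suc k) h≡0 =
  trans (cong₂ _+_ (h≡0 zero λ ())
                   (Σ-single n (λ i → h (suc i)) k (λ j j≢k → h≡0 (suc j) (j≢k ∘ Fin.suc-injective))))
        (+-identityˡ (h (suc k)))

minor : ∀ {n} → (Fin (suc n) → Fin (suc n) → ℚ) → Fin (suc n) → Fin n → Fin n → ℚ
minor M j r c = M (suc r) (punchIn j c)

laplace-term : ∀ n → (Fin (suc n) → Fin (suc n) → ℚ) → Fin (suc n) → ℚ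
laplace-term n M j = sign (toℕ j) * M zero j * det n (minor M j)

det-cong : ∀ n {M M' : Fin n → Fin n → ℚ} → (∀ r c → M r c ≡ M' r c) → det n M ≡ det n M'
det-cong zero    M≡M' = refl
det-cong (suc n) M≡M' = Σ-cong (suc n) λ j →
  cong₂ (λ x y → sign (toℕ j) * x * y) (M≡M' zero j) (det-cong n λ r c → M≡M' (suc r) (punchIn j c))

laplace-term-zero : ∀ n (M : Fin (suc n) → Fin (suc n) → ℚ) j →
                    M zero j ≡ 0ℚ ⊎ det n (minor M j) ≡ 0ℚ → laplace-term n M j ≡ 0ℚ
laplace-term-zero n M j (inj₁ entry≡0) =
  trans (cong (λ x → sign (toℕ j) * x * det n (minor M j)) entry≡0)
        (solve (sign (toℕ j)) (det n (minor M j)))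
  where
  solve : ∀ s d → s * 0ℚ * d ≡ 0ℚ
  solve = solve-∀ ℚ-ring
laplace-term-zero n M j (inj₂ minor≡0) =
  trans (cong (sign (toℕ j) * M zero j *_) minor≡0) (*-zeroʳ (sign (toℕ j) * M zero j))

det-zero-column : ∀ n (M : Fin n → Fin n → ℚ) c → (∀ r → M r c ≡ 0ℚ) → det n M ≡ 0ℚ
det-zero-column (suc n) M c column≡0 = Σ-zero (suc n) (laplace-term n M) term≡0
  where
  term≡0 : ∀ j → laplace-term n M j ≡ 0ℚ
  term≡0 j with j Fin.≟ c
  ... | yes refl = laplace-term-zero n M j (inj₁ (column≡0 zero))
  ... | no j≢c   = laplace-term-zero n M j (inj₂ (det-zero-column n (minor M j) (punchOut j≢c)
                     λ r → trans (cong (M (suc r)) (Fin.punchIn-punchOut j≢c)) (column≡0 (suc r))))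

sign-suc : ∀ n → sign (suc n) ≡ - sign n
sign-suc zero    = refl
sign-suc (suc n) = sym (trans (cong -_ (sign-suc n)) (neg-involutive (sign n)))

if-yes : ∀ {P A : Set} (d : Dec P) → P → {x y : A} → (if does d then x else y) ≡ x
if-yes d p {x} {y} = cong (λ b → if b then x else y) (dec-true d p)

if-no : ∀ {P A : Set} (d : Dec P) → ¬ P → {x y : A} → (if does d then x else y) ≡ y
if-no d ¬p {x} {y} = cong (λ b → if b then x else y) (dec-false d ¬p)

punchIn-fromℕ : ∀ n (c : Fin n) → punchIn (fromℕ n) c ≡ inject₁ c
punchIn-fromℕ (suc n) zero    = refl
punchIn-fromℕ (suc n) (suc c) = cong suc (punchIn-fromℕ n c)

module Reciprocal (f : Series) where

  f⁺ : Series
  f⁺ k = f (suc k)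

  hessenberg : (m : ℕ) → Series → Fin m → Fin m → ℚ
  hessenberg m g r zero    = g (toℕ r)
  hessenberg m g r (suc c) = if does (toℕ c ℕ.≤? toℕ r) then f (toℕ r ∸ toℕ c) else 0ℚ

  reciprocal : Series
  reciprocal p = sign p * det p (hessenberg p f⁺)

  private
    ≤?-suc : ∀ a b → does (suc a ℕ.≤? suc b) ≡ does (a ℕ.≤? b)
    ≤?-suc zero    b = refl
    ≤?-suc (suc a) b = refl

    hessenberg-shift : ∀ m g g' (r : Fin (suc m)) (c : Fin m) →
      hessenberg (suc (suc m)) g (suc r) (suc (suc c)) ≡ hessenberg (suc m) g' r (suc c)
    hessenberg-shift m g g' r c =
      cong (λ b → if b then f (toℕ r ∸ toℕ c) else 0ℚ) (≤?-suc (toℕ c) (toℕ r))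

  det-hessenberg : ∀ m g → det (suc (suc m)) (hessenberg (suc (suc m)) g)
    ≡ g 0 * det (suc m) (hessenberg (suc m) f⁺) + - (f 0 * det (suc m) (hessenberg (suc m) (λ k → g (suc k))))
  det-hessenberg m g = begin
    h zero + (h (suc zero) + Σ m (λ j → h (suc (suc j))))
      ≡⟨ cong₂ (λ x y → 1ℚ * g 0 * x + (- 1ℚ * f 0 * y + Σ m (λ j → h (suc (suc j)))))
               (det-cong (suc m) minor₀) (det-cong (suc m) minor₁) ⟩
    1ℚ * g 0 * X + (- 1ℚ * f 0 * Y + Σ m (λ j → h (suc (suc j))))
      ≡⟨ cong (λ z → 1ℚ * g 0 * X + (- 1ℚ * f 0 * Y + z))
              (Σ-zero m (λ j → h (suc (suc j))) λ j → laplace-term-zero (suc m) M (suc (suc j)) (inj₁ refl)) ⟩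
    1ℚ * g 0 * X + (- 1ℚ * f 0 * Y + 0ℚ)
      ≡⟨ solve (g 0) X (f 0) Y ⟩
    g 0 * X + - (f 0 * Y)
      ∎
    where
    M = hessenberg (suc (suc m)) g
    h = laplace-term (suc m) M
    X = det (suc m) (hessenberg (suc m) f⁺)
    Y = det (suc m) (hessenberg (suc m) (λ k → g (suc k)))
    minor₀ : ∀ r c → minor M zero r c ≡ hessenberg (suc m) f⁺ r c
    minor₀ r zero    = refl
    minor₀ r (suc c) = hessenberg-shift m g f⁺ r c
    minor₁ : ∀ r c → minor M (suc zero) r c ≡ hessenberg (suc m) (λ k → g (suc k)) r c
    minor₁ r zero    = refl
    minor₁ r (suc c) = hessenberg-shift m g (λ k → g (suc k)) r c
    solve : ∀ a x b y → 1ℚ * a * x + (- 1ℚ * b * y + 0ℚ) ≡ a * x + - (b * y)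
    solve = solve-∀ ℚ-ring

  module _ (f₀≡1 : f 0 ≡ 1ℚ) where

    -- Expanding along the first row makes this the recursion that defines the reciprocal.
    signed-det-hessenberg : ∀ m g → sign (suc m) * det (suc m) (hessenberg (suc m) g) ≡ - (g ⋆ reciprocal) m
    signed-det-hessenberg zero    g = solve (g 0)
      where
      solve : ∀ x → - 1ℚ * (1ℚ * x * 1ℚ + 0ℚ) ≡ - (x * (1ℚ * 1ℚ) + 0ℚ)
      solve = solve-∀ ℚ-ring
    signed-det-hessenberg (suc m) g = begin
      sign m * det (suc (suc m)) (hessenberg (suc (suc m)) g)
        ≡⟨ cong₂ _*_ (sign-suc (suc m)) (det-hessenberg m g) ⟩
      - s * (g 0 * X + - (f 0 * Y))
        ≡⟨ solve s (g 0) X (f 0) Y ⟩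
      - (g 0 * (s * X)) + f 0 * (s * Y)
        ≡⟨ cong₂ (λ a b → - (g 0 * (s * X)) + a * b) f₀≡1 (signed-det-hessenberg m g⁺) ⟩
      - (g 0 * (s * X)) + 1ℚ * - (g⁺ ⋆ reciprocal) m
        ≡⟨ solve′ (g 0 * (s * X)) ((g⁺ ⋆ reciprocal) m) ⟩
      - (g ⋆ reciprocal) (suc m)
        ∎
      where
      s = sign (suc m)
      g⁺ : Series
      g⁺ k = g (suc k)
      X = det (suc m) (hessenberg (suc m) f⁺)
      Y = det (suc m) (hessenberg (suc m) g⁺)
      solve : ∀ s a x b y → - s * (a * x + - (b * y)) ≡ - (a * (s * x)) + b * (s * y)
      solve = solve-∀ ℚ-ring
      solve′ : ∀ a c → - a + 1ℚ * - c ≡ - (a + c)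
      solve′ = solve-∀ ℚ-ring

    reciprocal-⋆ : reciprocal ⋆ f ≗ 𝟙
    reciprocal-⋆ zero    = cong (λ x → 1ℚ * 1ℚ * x + 0ℚ) f₀≡1
    reciprocal-⋆ (suc m) = begin
      (reciprocal ⋆ f) (suc m)                          ≡⟨ ⋆-comm reciprocal f (suc m) ⟩
      f 0 * reciprocal (suc m) + (f⁺ ⋆ reciprocal) m    ≡⟨ cong₂ (λ a b → a * b + (f⁺ ⋆ reciprocal) m)
                                                                 f₀≡1 (signed-det-hessenberg m f⁺) ⟩
      1ℚ * - (f⁺ ⋆ reciprocal) m + (f⁺ ⋆ reciprocal) m  ≡⟨ solve ((f⁺ ⋆ reciprocal) m) ⟩
      0ℚ                                                ∎
      where
      solve : ∀ c → 1ℚ * - c + c ≡ 0ℚ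
      solve = solve-∀ ℚ-ring

  -- Row 0 of the shape matrix is (f 0, 0, …, 0, 1), and the minor of the f 0 entry has a zero column.
  det-shapeMatrix : ∀ p → det (suc p) (shapeMatrix p f) ≡ reciprocal p
  det-shapeMatrix zero    = refl
  det-shapeMatrix (suc q) = trans (Σ-single (suc p) (laplace-term p M) (fromℕ p) off-corner) corner
    where
    p = suc q
    M = shapeMatrix p f
    off-corner : ∀ j → j ≢ fromℕ p → laplace-term p M j ≡ 0ℚ
    off-corner zero    _     = laplace-term-zero p M zero (inj₂ (det-zero-column p (minor M zero) (fromℕ q)
      λ r → if-yes (suc (toℕ (fromℕ q)) ℕ.≟ p) (cong suc (Fin.toℕ-fromℕ q))))
    off-corner (suc j) j≢p = laplace-term-zero p M (suc j) (inj₁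
      (if-no (suc (toℕ j) ℕ.≟ p) (j≢p ∘ Fin.toℕ-injective ∘ toℕ-j≡p)))
      where
      toℕ-j≡p : suc (toℕ j) ≡ p → toℕ (suc j) ≡ toℕ (fromℕ p)
      toℕ-j≡p eq = trans eq (sym (Fin.toℕ-fromℕ p))
    hessenberg-minor : ∀ r c → minor M (fromℕ p) r c ≡ hessenberg p f⁺ r c
    hessenberg-minor r c = begin
      M (suc r) (punchIn (fromℕ p) c)
        ≡⟨ cong (M (suc r)) (punchIn-fromℕ p c) ⟩
      M (suc r) (inject₁ c)
        ≡⟨ if-no (toℕ (inject₁ c) ℕ.≟ p) (inject₁≢p ∘ trans (sym (Fin.toℕ-inject₁ c))) ⟩
      (if does (toℕ (inject₁ c) ℕ.≤? suc (toℕ r)) then f (suc (toℕ r) ∸ toℕ (inject₁ c)) else 0ℚ)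
        ≡⟨ cong (λ t → if does (t ℕ.≤? suc (toℕ r)) then f (suc (toℕ r) ∸ t) else 0ℚ) (Fin.toℕ-inject₁ c) ⟩
      (if does (toℕ c ℕ.≤? suc (toℕ r)) then f (suc (toℕ r) ∸ toℕ c) else 0ℚ)
        ≡⟨ shifted-column c ⟩
      hessenberg p f⁺ r c
        ∎
      where
      inject₁≢p : toℕ c ≢ p
      inject₁≢p eq = ℕ.<-irrefl eq (Fin.toℕ<n c)
      shifted-column : ∀ c → (if does (toℕ c ℕ.≤? suc (toℕ r)) then f (suc (toℕ r) ∸ toℕ c) else 0ℚ)
                             ≡ hessenberg p f⁺ r c
      shifted-column zero    = refl
      shifted-column (suc c) = cong (λ b → if b then f (toℕ r ∸ toℕ c) else 0ℚ) (≤?-suc (toℕ c) (toℕ r))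
    corner : laplace-term p M (fromℕ p) ≡ reciprocal p
    corner = begin
      sign (toℕ (fromℕ p)) * M zero (fromℕ p) * det p (minor M (fromℕ p))
        ≡⟨ cong (λ x → sign (toℕ (fromℕ p)) * x * det p (minor M (fromℕ p)))
                (if-yes (toℕ (fromℕ p) ℕ.≟ p) (Fin.toℕ-fromℕ p)) ⟩
      sign (toℕ (fromℕ p)) * 1ℚ * det p (minor M (fromℕ p))
        ≡⟨ cong₂ (λ n d → sign n * 1ℚ * d) (Fin.toℕ-fromℕ p) (det-cong p hessenberg-minor) ⟩
      sign p * 1ℚ * det p (hessenberg p f⁺)
        ≡⟨ cong (_* det p (hessenberg p f⁺)) (*-identityʳ (sign p)) ⟩
      reciprocal p
        ∎


reciprocal-spread-coefficient : ∀ x f → f 0 ≡ 1ℚ → x ⋆ spread f ≗ 𝟙 →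
                                ∀ p → x (2 ℕ.* p) ≡ det (suc p) (shapeMatrix p f)
reciprocal-spread-coefficient x f f₀≡1 x⋆f[z²]≗𝟙 p = begin
  x (2 ℕ.* p)                        ≡⟨ inverse-unique x (spread reciprocal) (spread f) x⋆f[z²]≗𝟙
                                          (spread-inverse reciprocal f (reciprocal-⋆ f₀≡1)) (2 ℕ.* p) ⟩
  spread reciprocal (2 ℕ.* p)        ≡⟨ spread-2* reciprocal p ⟩
  reciprocal p                       ≡⟨ det-shapeMatrix p ⟨
  det (suc p) (shapeMatrix p f)      ∎
  where open Reciprocal f

-- Hyperbolic series

2ℚ : ℚ
2ℚ = 1ℚ + 1ℚ

1^n≡1 : ∀ n → 1ℚ ^ n ≡ 1ℚ
1^n≡1 zero    = refl
1^n≡1 (suc n) = trans (*-identityˡ (1ℚ ^ n)) (1^n≡1 n)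

[-1]^[1+n] : ∀ n → (- 1ℚ) ^ suc n ≡ (if even? n then - 1ℚ else 1ℚ)
[-1]^[1+n] zero          = refl
[-1]^[1+n] (suc zero)    = refl
[-1]^[1+n] (suc (suc n)) = trans (solve ((- 1ℚ) ^ suc n)) ([-1]^[1+n] n)
  where
  solve : ∀ x → - 1ℚ * (- 1ℚ * x) ≡ x
  solve = solve-∀ ℚ-ring

[eˣᶻ-1]/z : ℚ → Series
[eˣᶻ-1]/z x k = exp x (suc k)

sinh[z]/z : Series
sinh[z]/z = spread (λ d → invFact (2 ℕ.* d ℕ.+ 1))

cosh : Series
cosh = spread (λ d → invFact (2 ℕ.* d))

sinh[z]/z-even? : ∀ n → sinh[z]/z n ≡ (if even? n then invFact (suc n) else 0ℚ)
sinh[z]/z-even? = spread-even? _ (λ j → invFact (suc j)) (λ d → cong invFact (ℕ.+-comm (2 ℕ.* d) 1))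

cosh-even? : ∀ n → cosh n ≡ (if even? n then invFact n else 0ℚ)
cosh-even? = spread-even? _ invFact (λ _ → refl)

2sinh[z]/z : ∀ n → 2ℚ * sinh[z]/z n ≡ exp 1ℚ (suc n) + - exp (- 1ℚ) (suc n)
2sinh[z]/z n = begin
  2ℚ * sinh[z]/z n                                        ≡⟨ cong (2ℚ *_) (sinh[z]/z-even? n) ⟩
  2ℚ * (if even? n then i else 0ℚ)                        ≡⟨ parity (even? n) ⟩
  1ℚ * i + - ((if even? n then - 1ℚ else 1ℚ) * i)         ≡⟨ cong₂ (λ u v → u * i + - (v * i)) (1^n≡1 (suc n)) ([-1]^[1+n] n) ⟨
  exp 1ℚ (suc n) + - exp (- 1ℚ) (suc n)                   ∎
  where
  i = invFact (suc n)
  parity : ∀ b → 2ℚ * (if b then i else 0ℚ) ≡ 1ℚ * i + - ((if b then - 1ℚ else 1ℚ) * i)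
  parity true  = solve i
    where
    solve : ∀ x → (1ℚ + 1ℚ) * x ≡ 1ℚ * x + - (- 1ℚ * x)
    solve = solve-∀ ℚ-ring
  parity false = solve i
    where
    solve : ∀ x → (1ℚ + 1ℚ) * 0ℚ ≡ 1ℚ * x + - (1ℚ * x)
    solve = solve-∀ ℚ-ring

-- (exp x ⋆ b) (suc n) unfolds to exp x 0 * b (suc n) + ([eˣᶻ-1]/z x ⋆ b) n.
[eˣᶻ-1]/z-⋆ : ∀ x b n → ([eˣᶻ-1]/z x ⋆ b) n ≡ (exp x ⋆ b) (suc n) + - b (suc n)
[eˣᶻ-1]/z-⋆ x b n = solve (b (suc n)) (([eˣᶻ-1]/z x ⋆ b) n)
  where
  solve : ∀ y c → c ≡ (1ℚ * 1ℚ * y + c) + - y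
  solve = solve-∀ ℚ-ring

x·dilate-[eᶻ-1]/z : ∀ x → x · dilate x ([eˣᶻ-1]/z 1ℚ) ≗ [eˣᶻ-1]/z x
x·dilate-[eᶻ-1]/z x k = begin
  x * (x ^ k * (1ℚ ^ suc k * invFact (suc k)))   ≡⟨ cong (λ u → x * (x ^ k * (u * invFact (suc k)))) (1^n≡1 (suc k)) ⟩
  x * (x ^ k * (1ℚ * invFact (suc k)))           ≡⟨ solve x (x ^ k) (invFact (suc k)) ⟩
  x * x ^ k * invFact (suc k)                    ∎
  where
  solve : ∀ x p i → x * (p * (1ℚ * i)) ≡ x * p * i
  solve = solve-∀ ℚ-ring

reciprocal-sinh[z]/z : ∀ β → β ⋆ [eˣᶻ-1]/z 1ℚ ≗ 𝟙 →
                       (2ℚ · β ⊕ (- 1ℚ) · dilate 2ℚ β) ⋆ sinh[z]/z ≗ 𝟙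
reciprocal-sinh[z]/z β β⋆E₁≗𝟙 n = begin
  ((2ℚ · β ⊕ (- 1ℚ) · β̂) ⋆ T) n              ≡⟨ ⋆-distribʳ-⊕ (2ℚ · β) ((- 1ℚ) · β̂) T n ⟩
  ((2ℚ · β) ⋆ T) n + (((- 1ℚ) · β̂) ⋆ T) n    ≡⟨ cong₂ _+_ (·-⋆ 2ℚ β T n) (·-⋆ (- 1ℚ) β̂ T n) ⟩
  2ℚ * (β ⋆ T) n + - 1ℚ * (β̂ ⋆ T) n          ≡⟨ cong₂ (λ u v → u + - 1ℚ * v) (2β⋆T≗1+N n) (β̂⋆T≗N n) ⟩
  (𝟙 n + N n) + - 1ℚ * N n                   ≡⟨ solve (𝟙 n) (N n) ⟩
  𝟙 n                                        ∎
  where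
  E₁ = [eˣᶻ-1]/z 1ℚ
  N = exp (- 1ℚ)
  T = sinh[z]/z
  β̂ = dilate 2ℚ β
  Ŝ = dilate 2ℚ E₁
  solve : ∀ a b → (a + b) + - 1ℚ * b ≡ a
  solve = solve-∀ ℚ-ring

  E₁⋆[1+N]≗2T : E₁ ⋆ (𝟙 ⊕ N) ≗ 2ℚ · T
  E₁⋆[1+N]≗2T n = begin
    (E₁ ⋆ (𝟙 ⊕ N)) n
      ≡⟨ [eˣᶻ-1]/z-⋆ 1ℚ (𝟙 ⊕ N) n ⟩
    (exp 1ℚ ⋆ (𝟙 ⊕ N)) (suc n) + - (0ℚ + N (suc n))
      ≡⟨ cong (_+ - (0ℚ + N (suc n))) (⋆-distribˡ-⊕ (exp 1ℚ) 𝟙 N (suc n)) ⟩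
    ((exp 1ℚ ⋆ 𝟙) (suc n) + (exp 1ℚ ⋆ N) (suc n)) + - (0ℚ + N (suc n))
      ≡⟨ cong₂ (λ u v → (u + v) + - (0ℚ + N (suc n))) (⋆-𝟙 (exp 1ℚ) (suc n))
               (trans (exp-⋆ 1ℚ (- 1ℚ) (suc n)) (exp-0 (suc n))) ⟩
    (exp 1ℚ (suc n) + 0ℚ) + - (0ℚ + N (suc n))
      ≡⟨ solve′ (exp 1ℚ (suc n)) (N (suc n)) ⟩
    exp 1ℚ (suc n) + - N (suc n)
      ≡⟨ 2sinh[z]/z n ⟨
    2ℚ * T n
      ∎
    where
    solve′ : ∀ e m → (e + 0ℚ) + - (0ℚ + m) ≡ e + - m
    solve′ = solve-∀ ℚ-ring

  2β⋆T≗1+N : ∀ n → 2ℚ * (β ⋆ T) n ≡ (𝟙 ⊕ N) n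
  2β⋆T≗1+N n = begin
    2ℚ * (β ⋆ T) n           ≡⟨ ⋆-· 2ℚ β T n ⟨
    (β ⋆ (2ℚ · T)) n         ≡⟨ ⋆-congʳ β (λ k → sym (E₁⋆[1+N]≗2T k)) n ⟩
    (β ⋆ (E₁ ⋆ (𝟙 ⊕ N))) n   ≡⟨ inverse-⋆-cancel β E₁ (𝟙 ⊕ N) β⋆E₁≗𝟙 n ⟩
    (𝟙 ⊕ N) n                ∎

  Ŝ⋆N≗T : Ŝ ⋆ N ≗ T
  Ŝ⋆N≗T n = *-cancelˡ-≡ 2ℚ (begin
    2ℚ * (Ŝ ⋆ N) n                        ≡⟨ ·-⋆ 2ℚ Ŝ N n ⟨
    ((2ℚ · Ŝ) ⋆ N) n                      ≡⟨ ⋆-congˡ N (x·dilate-[eᶻ-1]/z 2ℚ) n ⟩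
    ([eˣᶻ-1]/z 2ℚ ⋆ N) n                  ≡⟨ [eˣᶻ-1]/z-⋆ 2ℚ N n ⟩
    (exp 2ℚ ⋆ N) (suc n) + - N (suc n)    ≡⟨ cong (_+ - N (suc n)) (exp-⋆ 2ℚ (- 1ℚ) (suc n)) ⟩
    exp 1ℚ (suc n) + - N (suc n)          ≡⟨ 2sinh[z]/z n ⟨
    2ℚ * T n                              ∎)

  β̂⋆T≗N : β̂ ⋆ T ≗ N
  β̂⋆T≗N n = trans (⋆-congʳ β̂ (λ k → sym (Ŝ⋆N≗T k)) n)
                  (inverse-⋆-cancel β̂ Ŝ N (dilate-inverse 2ℚ β E₁ β⋆E₁≗𝟙) n)

-- Bernoulli and Euler numbers

lookup-∷ʳ-fromℕ : ∀ {A : Set} {n} (xs : Vec A n) x → lookup (xs ∷ʳ x) (fromℕ n) ≡ x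
lookup-∷ʳ-fromℕ []       x = refl
lookup-∷ʳ-fromℕ (y ∷ xs) x = lookup-∷ʳ-fromℕ xs x

lookup-∷ʳ-inject₁ : ∀ {A : Set} {n} (xs : Vec A n) x i → lookup (xs ∷ʳ x) (inject₁ i) ≡ lookup xs i
lookup-∷ʳ-inject₁ (y ∷ xs) x zero    = refl
lookup-∷ʳ-inject₁ (y ∷ xs) x (suc i) = lookup-∷ʳ-inject₁ xs x i

module SnocTable {A : Set} (table : ∀ n → Vec A (suc n)) (next : ℕ → A)
                 (table-suc : ∀ n → table (suc n) ≡ table n ∷ʳ next n) where

  entry : ℕ → A
  entry n = lookup (table n) (fromℕ n)

  entry-suc : ∀ n → entry (suc n) ≡ next n
  entry-suc n = trans (cong (λ t → lookup t (fromℕ (suc n))) (table-suc n)) (lookup-∷ʳ-fromℕ (table n) (next n))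

  lookup-table : ∀ n (k : Fin (suc n)) → lookup (table n) k ≡ entry (toℕ k)
  lookup-table zero    zero = refl
  lookup-table (suc n) k with view k
  ... | ‵fromℕ     = cong entry (sym (Fin.toℕ-fromℕ (suc n)))
  ... | ‵inject₁ j = begin
    lookup (table (suc n)) (inject₁ j)        ≡⟨ cong (λ t → lookup t (inject₁ j)) (table-suc n) ⟩
    lookup (table n ∷ʳ next n) (inject₁ j)    ≡⟨ lookup-∷ʳ-inject₁ (table n) (next n) j ⟩
    lookup (table n) j                        ≡⟨ lookup-table n j ⟩
    entry (toℕ j)                             ≡⟨ cong entry (Fin.toℕ-inject₁ j) ⟨
    entry (toℕ (inject₁ j))                   ∎

bernoulli-recurrence : ∀ m → bernoulli (suc m)
  ≡ - (sum (suc m) (λ k → fromℕ' ((2 ℕ.+ m) C k) * bernoulli k) * (ℤ.+ 1 / (2 ℕ.+ m)))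
bernoulli-recurrence m = trans (entry-suc m) (cong (λ x → - (x * (ℤ.+ 1 / (2 ℕ.+ m))))
  (trans (Σ-cong (suc m) (λ k → cong (fromℕ' ((2 ℕ.+ m) C toℕ k) *_) (lookup-table m k)))
         (Σ≡sum (suc m) (λ k → fromℕ' ((2 ℕ.+ m) C k) * bernoulli k))))
  where open SnocTable bernTable _ (λ _ → refl)

euler-recurrence : ∀ m → euler (suc m)
  ≡ - sum (suc m) (λ k → if even? (suc m ∸ k) then fromℕ' (suc m C k) * euler k else 0ℚ)
euler-recurrence m = trans (entry-suc m) (cong -_
  (trans (Σ-cong (suc m) (λ k → cong (λ x → if even? (suc m ∸ toℕ k) then fromℕ' (suc m C toℕ k) * x else 0ℚ)
                                      (lookup-table m k)))
         (Σ≡sum (suc m) (λ k → if even? (suc m ∸ k) then fromℕ' (suc m C k) * euler k else 0ℚ))))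
  where open SnocTable eulerTable _ (λ _ → refl)

bernoulliSeries : Series
bernoulliSeries k = bernoulli k * invFact k

eulerSeries : Series
eulerSeries k = euler k * invFact k

bernoulliSeries-⋆ : bernoulliSeries ⋆ [eˣᶻ-1]/z 1ℚ ≗ 𝟙
bernoulliSeries-⋆ zero    = refl
bernoulliSeries-⋆ (suc m) = begin
  sum n (λ k → bernoulliSeries k * [eˣᶻ-1]/z 1ℚ (suc m ∸ k))   ≡⟨ sum-cong n term ⟩
  sum n (λ k → c * g k)                                       ≡⟨ *-distribˡ-sum n c g ⟨
  c * sum n g                                                 ≡⟨ cong (c *_) (sum-snoc (suc m) g) ⟩
  c * (X + fromℕ' (n C suc m) * bernoulli (suc m))            ≡⟨ cong₂ (λ u v → c * (X + fromℕ' u * v))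
                                                                       nC[n∸1]≡n (bernoulli-recurrence m) ⟩
  c * (X + fromℕ' n * - (X * r))                              ≡⟨ solve c X (fromℕ' n) r ⟩
  c * (X + - (X * (r * fromℕ' n)))                            ≡⟨ cong (λ w → c * (X + - (X * w))) (/-*-fromℕ' (ℤ.+ 1) n) ⟩
  c * (X + - (X * 1ℚ))                                        ≡⟨ solve′ c X ⟩
  0ℚ                                                          ∎
  where
  n = suc (suc m)
  c = invFact n
  r = ℤ.+ 1 / n
  g : ℕ → ℚ
  g k = fromℕ' (n C k) * bernoulli k
  X = sum (suc m) g
  nC[n∸1]≡n : n C suc m ≡ n
  nC[n∸1]≡n = trans (nCk≡nC[n∸k] (ℕ.n≤1+n (suc m))) (trans (cong (n C_) (ℕ.m+n∸n≡m 1 m)) (nC1≡n n))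
  term : ∀ k → k < n → bernoulliSeries k * [eˣᶻ-1]/z 1ℚ (suc m ∸ k) ≡ c * g k
  term k k<n = begin
    bernoulli k * invFact k * (1ℚ ^ suc (suc m ∸ k) * invFact (suc (suc m ∸ k)))
      ≡⟨ cong₂ (λ u j → bernoulli k * invFact k * (u * invFact j))
               (1^n≡1 (suc (suc m ∸ k))) (sym (ℕ.+-∸-assoc 1 (ℕ.≤-pred k<n))) ⟩
    bernoulli k * invFact k * (1ℚ * invFact (n ∸ k))
      ≡⟨ solve″ (bernoulli k) (invFact k) (invFact (n ∸ k)) ⟩
    bernoulli k * (invFact k * invFact (n ∸ k))
      ≡⟨ cong (bernoulli k *_) (invFact-binomial (ℕ.<⇒≤ k<n)) ⟩
    bernoulli k * (fromℕ' (n C k) * c)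
      ≡⟨ solve‴ (bernoulli k) (fromℕ' (n C k)) c ⟩
    c * g k
      ∎
    where
    solve″ : ∀ b i j → b * i * (1ℚ * j) ≡ b * (i * j)
    solve″ = solve-∀ ℚ-ring
    solve‴ : ∀ b C c → b * (C * c) ≡ c * (C * b)
    solve‴ = solve-∀ ℚ-ring
  solve : ∀ c X F r → c * (X + F * - (X * r)) ≡ c * (X + - (X * (r * F)))
  solve = solve-∀ ℚ-ring
  solve′ : ∀ c X → c * (X + - (X * 1ℚ)) ≡ 0ℚ
  solve′ = solve-∀ ℚ-ring

eulerSeries-⋆ : eulerSeries ⋆ cosh ≗ 𝟙
eulerSeries-⋆ zero    = refl
eulerSeries-⋆ (suc m) = begin
  sum (suc n) (λ k → eulerSeries k * cosh (n ∸ k))   ≡⟨ sum-cong (suc n) (λ k k≤n → term k (ℕ.≤-pred k≤n)) ⟩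
  sum (suc n) (λ k → c * g k)                        ≡⟨ *-distribˡ-sum (suc n) c g ⟨
  c * sum (suc n) g                                  ≡⟨ cong (c *_) (sum-snoc n g) ⟩
  c * (X + g n)                                      ≡⟨ cong (λ w → c * (X + w)) last-term ⟩
  c * (X + 1ℚ * - X)                                 ≡⟨ solve c X ⟩
  0ℚ                                                 ∎
  where
  n = suc m
  c = invFact n
  g : ℕ → ℚ
  g k = if even? (n ∸ k) then fromℕ' (n C k) * euler k else 0ℚ
  X = sum n g
  term : ∀ k → k ≤ n → eulerSeries k * cosh (n ∸ k) ≡ c * g k
  term k k≤n = trans (cong (eulerSeries k *_) (cosh-even? (n ∸ k))) (parity (even? (n ∸ k)))
    where
    parity : ∀ b → eulerSeries k * (if b then invFact (n ∸ k) else 0ℚ)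
                   ≡ c * (if b then fromℕ' (n C k) * euler k else 0ℚ)
    parity true  = begin
      euler k * invFact k * invFact (n ∸ k)     ≡⟨ *-assoc (euler k) (invFact k) (invFact (n ∸ k)) ⟩
      euler k * (invFact k * invFact (n ∸ k))   ≡⟨ cong (euler k *_) (invFact-binomial k≤n) ⟩
      euler k * (fromℕ' (n C k) * c)            ≡⟨ solve′ (euler k) (fromℕ' (n C k)) c ⟩
      c * (fromℕ' (n C k) * euler k)            ∎
      where
      solve′ : ∀ e C c → e * (C * c) ≡ c * (C * e)
      solve′ = solve-∀ ℚ-ring
    parity false = trans (*-zeroʳ (eulerSeries k)) (sym (*-zeroʳ c))
  last-term : g n ≡ 1ℚ * - X
  last-term = begin
    (if even? (n ∸ n) then fromℕ' (n C n) * euler n else 0ℚ)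
      ≡⟨ cong (λ j → if even? j then fromℕ' (n C n) * euler n else 0ℚ) (ℕ.n∸n≡0 n) ⟩
    fromℕ' (n C n) * euler n
      ≡⟨ cong₂ (λ u v → fromℕ' u * v) (nCn≡1 n) (euler-recurrence m) ⟩
    1ℚ * - X
      ∎
  solve : ∀ c X → c * (X + 1ℚ * - X) ≡ 0ℚ
  solve = solve-∀ ℚ-ring

fromℕ'!*[x*invFact] : ∀ m x → fromℕ' (m !) * (x * invFact m) ≡ x
fromℕ'!*[x*invFact] m x = begin
  fromℕ' (m !) * (x * invFact m)   ≡⟨ solve (fromℕ' (m !)) x (invFact m) ⟩
  x * (invFact m * fromℕ' (m !))   ≡⟨ cong (x *_) (invFact-inverse m) ⟩
  x * 1ℚ                           ≡⟨ *-identityʳ x ⟩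
  x                                ∎
  where
  solve : ∀ F x i → F * (x * i) ≡ x * (i * F)
  solve = solve-∀ ℚ-ring

2ℚ^n≡[2^n∸2]+2 : ∀ n .{{_ : NonZero n}} → 2ℚ ^ n ≡ fromℕ' (2 ℕ.^ n ∸ 2) + 2ℚ
2ℚ^n≡[2^n∸2]+2 n@(suc k) = begin
  2ℚ ^ n                            ≡⟨ fromℕ'-^ 2 n ⟨
  fromℕ' (2 ℕ.^ n)                  ≡⟨ cong fromℕ' (ℕ.m∸n+n≡m 2≤2^n) ⟨
  fromℕ' (2 ℕ.^ n ∸ 2 ℕ.+ 2)        ≡⟨ fromℕ'-+ (2 ℕ.^ n ∸ 2) 2 ⟩
  fromℕ' (2 ℕ.^ n ∸ 2) + 2ℚ         ∎
  where
  2≤2^n : 2 ≤ 2 ℕ.^ n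
  2≤2^n = ℕ.*-monoʳ-≤ 2 (ℕ.m^n>0 2 k)

bernoulli[2p]-coefficient : ∀ p →
  2ℚ * bernoulliSeries (2 ℕ.* p) + - 1ℚ * (2ℚ ^ (2 ℕ.* p) * bernoulliSeries (2 ℕ.* p)) ≡ det (suc p) (U p)
bernoulli[2p]-coefficient = reciprocal-spread-coefficient
  (2ℚ · bernoulliSeries ⊕ (- 1ℚ) · dilate 2ℚ bernoulliSeries) (λ d → invFact (2 ℕ.* d ℕ.+ 1)) refl
  (reciprocal-sinh[z]/z bernoulliSeries bernoulliSeries-⋆)

euler[2p]-coefficient : ∀ p → eulerSeries (2 ℕ.* p) ≡ det (suc p) (V p)
euler[2p]-coefficient = reciprocal-spread-coefficient eulerSeries (λ d → invFact (2 ℕ.* d)) refl eulerSeries-⋆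

mainTheorem14 : (p : ℕ) → (1≤p : 1 ≤ p) →
    (bernoulli (2 *ℕ p) ≡ - (coeffB p 1≤p * det (suc p) (U p)))
    × (euler (2 *ℕ p) ≡ fromℕ' ((2 *ℕ p) !) * det (suc p) (V p))
mainTheorem14 p@(suc _) 1≤p = bernoulli-det , euler-det
  where
  n = 2 *ℕ p
  b = bernoulliSeries n
  G = fromℕ' (2 ℕ.^ n ∸ 2)
  cB = coeffB p 1≤p
  cB*G≡n! : cB * G ≡ fromℕ' (n !)
  cB*G≡n! = /-*-fromℕ' (ℤ.+ (n !)) (2 ℕ.^ n ∸ 2) {{denomNZ p 1≤p}}
  solve : ∀ c G b t → c * G * b ≡ - (c * (t * b + - 1ℚ * ((G + t) * b)))
  solve = solve-∀ ℚ-ring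
  bernoulli-det = begin
    bernoulli n                                  ≡⟨ fromℕ'!*[x*invFact] n (bernoulli n) ⟨
    fromℕ' (n !) * b                             ≡⟨ cong (_* b) cB*G≡n! ⟨
    cB * G * b                                   ≡⟨ solve cB G b 2ℚ ⟩
    - (cB * (2ℚ * b + - 1ℚ * ((G + 2ℚ) * b)))   ≡⟨ cong (λ t → - (cB * (2ℚ * b + - 1ℚ * (t * b)))) (2ℚ^n≡[2^n∸2]+2 n) ⟨
    - (cB * (2ℚ * b + - 1ℚ * (2ℚ ^ n * b)))      ≡⟨ cong (λ t → - (cB * t)) (bernoulli[2p]-coefficient p) ⟩
    - (cB * det (suc p) (U p))                   ∎
  euler-det = begin
    euler n                                      ≡⟨ fromℕ'!*[x*invFact] n (euler n) ⟨
    fromℕ' (n !) * eulerSeries n                 ≡⟨ cong (fromℕ' (n !) *_) (euler[2p]-coefficient p) ⟩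
    fromℕ' (n !) * det (suc p) (V p)             ∎
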